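{- Let $m,n\ge 1$. If the complete bipartite graph $K_{m,n}$ is a subgraph of $\mathcal{G}_\infty$, then there exist a set $\{p_1,\dots,p_m\}$ of $m$ primes and a set $\{r_1,\dots,r_{n-1}\}$ of $n-1$ positive integers such that $p_i+r_j$ is prime for all $(i,j)\in\{1,\dots,m\}\times\{1,\dots,n-1\}$.
   Context: Let $\mathcal{P}$ be the set of odd primes. $\mathcal{G}_\infty$ is the simple undirected graph whose vertex set is the set of non-negative even integers, in which distinct $a,b$ are adjacent iff $\frac{a+b}{2}\in\mathcal{P}$ and $\frac{|a-b|}{2}\in\mathcal{P}$. -}

module Defs where

open import Data.Nat using (ℕ; _+_; _*_; _/_; ∣_-_∣)
open import Data.Nat.Primality using (Prime)
open import Data.Nat.Divisibility using (_∣_)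
open import Data.Product using (_×_; Σ)
open import Data.Sum using (_⊎_; inj₁; inj₂)
open import Data.Fin using (Fin)
open import Function.Definitions using (Injective)
open import Relation.Binary.PropositionalEquality using (_≡_; _≢_)
open import Relation.Nullary using (¬_)

OddPrime : ℕ → Set
OddPrime p = Prime p × p ≢ 2

IsVertex : ℕ → Set
IsVertex a = 2 ∣ a

Adj∞ : ℕ → ℕ → Set
Adj∞ a b = a ≢ b × OddPrime ((a + b) / 2) × OddPrime (∣ a - b ∣ / 2)

KSubgraph : ℕ → ℕ → Set
KSubgraph m n =
  Σ (Fin m ⊎ Fin n → ℕ) λ f →
    Injective _≡_ _≡_ f
    × (∀ v → IsVertex (f v))
    × (∀ (i : Fin m) (j : Fin n) → Adj∞ (f (inj₁ i)) (f (inj₂ j)))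

-- Halve every vertex: the m + n halves are distinct, and each edge says that
-- a_i + b_j is prime. Let b_0 be the smallest right half; then p_i = a_i + b_0
-- are distinct primes, and the remaining right halves give distinct positive
-- shifts r_j = b_j - b_0 with p_i + r_j = a_i + b_j prime.
module Submission where

open import Defs
open import Data.Nat using (ℕ; _+_; _∸_; _≤_; _<_; zero; suc; _/_; _≤?_)
open import Data.Nat.Properties
  using (≤-refl; ≤-trans; <⇒≤; ≰⇒>; ≤∧≢⇒<; m<n⇒0<n∸m; m+[n∸m]≡n; +-cancelʳ-≡; +-assoc)
open import Data.Nat.DivMod using (+-distrib-/-∣ʳ; /-cancelʳ-≡)
open import Data.Nat.Divisibility using (_∣_)
open import Data.Nat.Primality using (Prime)
open import Data.Fin using (Fin; punchIn) renaming (zero to fzero; suc to fsuc)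
open import Data.Fin.Properties using (punchIn-injective; punchInᵢ≢i)
open import Data.Product using (Σ; _×_; _,_; proj₁; proj₂)
open import Data.Sum using (_⊎_; inj₁; inj₂)
open import Data.Sum.Properties using (inj₁-injective; inj₂-injective)
open import Function using (_∘_)
open import Function.Definitions using (Injective)
open import Relation.Binary.PropositionalEquality
open import Relation.Nullary using (yes; no)

argmin : ∀ {k} (g : Fin (suc k) → ℕ) → Σ (Fin (suc k)) λ i → ∀ j → g i ≤ g j
argmin {zero} g = fzero , λ { fzero → ≤-refl }
argmin {suc k} g with argmin (g ∘ fsuc)
... | i , g[i]≤ with g fzero ≤? g (fsuc i)
...   | yes g[0]≤g[i] = fzero , λ { fzero → ≤-refl ; (fsuc j) → ≤-trans g[0]≤g[i] (g[i]≤ j) }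
...   | no  g[0]≰g[i] = fsuc i , λ { fzero → <⇒≤ (≰⇒> g[0]≰g[i]) ; (fsuc j) → g[i]≤ j }

module GapsAboveMinimum {k} (g : Fin (suc k) → ℕ) (g-injective : Injective _≡_ _≡_ g)
                        (i₀ : Fin (suc k)) (g-minimal : ∀ j → g i₀ ≤ g j) where

  gap : Fin k → ℕ
  gap j = g (punchIn i₀ j) ∸ g i₀

  minimum+gap : ∀ j → g i₀ + gap j ≡ g (punchIn i₀ j)
  minimum+gap j = m+[n∸m]≡n (g-minimal (punchIn i₀ j))

  gap-injective : Injective _≡_ _≡_ gap
  gap-injective {j} {j′} gap-j≡gap-j′ = punchIn-injective i₀ j j′ (g-injective (begin
    g (punchIn i₀ j)   ≡⟨ minimum+gap j ⟨
    g i₀ + gap j       ≡⟨ cong (g i₀ +_) gap-j≡gap-j′ ⟩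
    g i₀ + gap j′      ≡⟨ minimum+gap j′ ⟩
    g (punchIn i₀ j′)  ∎))
    where open ≡-Reasoning

  gap-positive : ∀ j → 0 < gap j
  gap-positive j = m<n⇒0<n∸m (≤∧≢⇒< (g-minimal (punchIn i₀ j))
    (λ g[i₀]≡g[j] → punchInᵢ≢i i₀ j (sym (g-injective g[i₀]≡g[j]))))

PrimesWithPrimeShifts : ℕ → ℕ → Set
PrimesWithPrimeShifts m k =
  Σ (Fin m → ℕ) λ p → Σ (Fin k → ℕ) λ r →
    Injective _≡_ _≡_ p × (∀ i → Prime (p i))
    × Injective _≡_ _≡_ r × (∀ j → 0 < r j)
    × (∀ i j → Prime (p i + r j))

primeSumTable⇒primesWithPrimeShifts :
  ∀ {m k} (a : Fin m → ℕ) (b : Fin (suc k) → ℕ) →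
  Injective _≡_ _≡_ a → Injective _≡_ _≡_ b → (∀ i j → Prime (a i + b j)) →
  PrimesWithPrimeShifts m k
primeSumTable⇒primesWithPrimeShifts {m} {k} a b a-injective b-injective a+b-prime =
  p , gap , p-injective , p-prime , gap-injective , gap-positive , p+gap-prime
  where
  j₀ : Fin (suc k)
  j₀ = proj₁ (argmin b)
  open GapsAboveMinimum b b-injective j₀ (proj₂ (argmin b))

  p : Fin m → ℕ
  p i = a i + b j₀

  p-injective : Injective _≡_ _≡_ p
  p-injective = a-injective ∘ +-cancelʳ-≡ (b j₀) _ _

  p-prime : ∀ i → Prime (p i)
  p-prime i = a+b-prime i j₀

  p+gap-prime : ∀ i j → Prime (p i + gap j)
  p+gap-prime i j = subst Prime
    (trans (cong (a i +_) (sym (minimum+gap j))) (sym (+-assoc (a i) (b j₀) (gap j))))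
    (a+b-prime i (punchIn j₀ j))

Adj∞⇒prime-half-sum : ∀ {a b} → 2 ∣ b → Adj∞ a b → Prime (a / 2 + b / 2)
Adj∞⇒prime-half-sum {a} 2∣b (_ , (sum-prime , _) , _) = subst Prime (+-distrib-/-∣ʳ a 2∣b) sum-prime

mainTheorem10 : ∀ (m n : ℕ) → 1 ≤ m → 1 ≤ n → KSubgraph m n →
    Σ (Fin m → ℕ) λ p → Σ (Fin (n ∸ 1) → ℕ) λ r →
      Injective _≡_ _≡_ p × (∀ i → Prime (p i))
      × Injective _≡_ _≡_ r × (∀ j → 0 < r j)
      × (∀ i j → Prime (p i + r j))
mainTheorem10 m (suc k) _ _ (f , f-injective , f-even , adjacent) =
  primeSumTable⇒primesWithPrimeShifts (half ∘ inj₁) (half ∘ inj₂)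
    (inj₁-injective ∘ half-injective) (inj₂-injective ∘ half-injective)
    (λ i j → Adj∞⇒prime-half-sum (f-even (inj₂ j)) (adjacent i j))
  where
  half : Fin m ⊎ Fin (suc k) → ℕ
  half v = f v / 2

  half-injective : Injective _≡_ _≡_ half
  half-injective = f-injective ∘ /-cancelʳ-≡ (f-even _) (f-even _)
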